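{- For every $n\ge 1$, the paths $P_n$ and $P_{n+4}$ satisfy $b^A_g(P_{n+4})\le b^A_g(P_n)+2$ and $b^I_g(P_{n+4})\le b^I_g(P_n)+2$.
   Context: $P_n$ denotes the path on $n$ vertices. The balance game on a finite simple graph $G$ is played by two players, Admirable (A) and Impish (I), who alternately select a not-yet-labeled vertex of $G$ until all vertices are labeled; Admirable labels each vertex she selects by $0$ and Impish labels each vertex he selects by $1$. Each edge receives the sum modulo $2$ of the labels of its endpoints. Let $e_0$ and $e_1$ be the numbers of edges labeled $0$ and $1$ at the end; the discrepancy is $d=e_1-e_0$. Admirable tries to minimize $d$ and Impish tries to maximize $d$. $b^A_g(G)$ is the value of $d$ under optimal play when Admirable moves first, and $b^I_g(G)$ is the value under optimal play when Impish moves first. -}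

module Defs where

open import Data.Nat using (ℕ; zero; suc)
open import Data.Integer using (ℤ; _+_; _⊓_; _⊔_) renaming (-_ to neg)
open import Data.Integer as ℤ using (+_)
open import Data.Bool using (Bool; true; false; _xor_)
open import Data.Maybe using (Maybe; just; nothing)
open import Data.Fin using (Fin; zero; suc)
open import Data.Product using (_×_; _,_)
open import Data.List using (List; []; _∷_; map; foldr; allFin)
open import Data.Vec using (Vec; lookup; replicate; _[_]≔_)
open import Data.List using (filter)
open import Relation.Nullary using (Dec; yes; no)

Graph : ℕ → Set
Graph n = List (Fin n × Fin n)

pathEdges : (n : ℕ) → Graph n
pathEdges zero = []
pathEdges (suc zero) = []
pathEdges (suc (suc m)) =
  (zero , suc zero) ∷ map (λ { (i , j) → (suc i , suc j) }) (pathEdges (suc m))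

P : (n : ℕ) → Graph n
P = pathEdges

-- Labels: false = 0 (Admirable), true = 1 (Impish); nothing = not yet labeled.
Labeling : ℕ → Set
Labeling n = Vec (Maybe Bool) n

-- contribution of an edge: +1 if labeled 1 (endpoints differ), -1 if labeled 0.
edgeVal : Maybe Bool → Maybe Bool → ℤ
edgeVal (just a) (just b) with a xor b
... | true  = + 1
... | false = neg (+ 1)
edgeVal _ _ = + 0

discrepancy : ∀ {n} → Graph n → Labeling n → ℤ
discrepancy G l = foldr (λ { (u , v) acc → edgeVal (lookup l u) (lookup l v) + acc }) (+ 0) G

data Player : Set where
  Admirable Impish : Player

other : Player → Player
other Admirable = Impish
other Impish = Admirable

label : Player → Bool
label Admirable = false
label Impish = true

isFree : Maybe Bool → Bool
isFree nothing = true
isFree (just _) = false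

freeVertices : ∀ {n} → Labeling n → List (Fin n)
freeVertices {n} l = go (allFin n)
  where
  go : List (Fin n) → List (Fin n)
  go [] = []
  go (v ∷ vs) with isFree (lookup l v)
  ... | true = v ∷ go vs
  ... | false = go vs

best : Player → ℤ → List ℤ → ℤ
best Admirable x [] = x
best Admirable x (y ∷ ys) = x ⊓ best Admirable y ys
best Impish x [] = x
best Impish x (y ∷ ys) = x ⊔ best Impish y ys

-- value (under optimal play) of the position with labeling l, player p to move;
-- the fuel k is the number of moves still to be played.
value : ∀ {n} → Graph n → ℕ → Player → Labeling n → ℤ
value G zero p l = discrepancy G l
value G (suc k) p l with map (λ v → value G k (other p) (l [ v ]≔ just (label p))) (freeVertices l)
... | [] = discrepancy G l
... | x ∷ xs = best p x xs

gameValue : ∀ {n} → Graph n → Player → ℤ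
gameValue {n} G p = value G n p (replicate n nothing)

bA : ∀ {n} → Graph n → ℤ
bA G = gameValue G Admirable

bI : ∀ {n} → Graph n → ℤ
bI G = gameValue G Impish

-- On P (4 + n) the copy of P n occupies the vertices 4, …, n + 3, and the four new vertices
-- 0, 1, 2, 3 form the pairs {0, 2} and {1, 3}. Admirable answers every move of Impish on a new
-- vertex at the other vertex of its pair, and otherwise plays an optimal strategy of P n on the
-- copy. Then 0 and 2 end with opposite labels, so the edges 01 and 12 cancel, while the edges
-- 23 and 34 contribute at most 2. Once the copy is full and Admirable has to move on the new
-- vertices, she plays 1 (or 0 if 1 and 3 are taken) and can still force 0 and 2 apart.
module Submission where

open import Defs
open import Data.Nat using (ℕ; _≥_)
open import Data.Integer using (_≤_; _+_; +_)
open import Data.Product using (_×_)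

open import Data.Nat using (zero; suc; z≤n)
import Data.Nat.Properties as ℕ
open import Data.Integer using (ℤ; -≤+; +≤+)
open import Data.Integer.Properties
  using (≤-refl; ≤-trans; +-assoc; +-comm; +-identityˡ; +-mono-≤; +-monoˡ-≤;
         ⊓-sel; ⊔-sel; i⊓j≤i; i⊓j≤j; i≤i⊔j; i≤j⊔i; module ≤-Reasoning)
open import Data.Bool using (Bool; true; false; not)
open import Data.Maybe using (Maybe; just; nothing)
open import Data.Fin using (Fin; zero; suc)
open import Data.List using (List; []; _∷_; map; allFin)
open import Data.List.Membership.Propositional using (_∈_)
open import Data.List.Membership.Propositional.Properties using (∈-map⁺; ∈-map⁻; ∈-allFin)
open import Data.List.Relation.Unary.Any using (here; there)
open import Data.Vec using ([]; _∷_; lookup; replicate; _[_]≔_)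
open import Data.Product using (∃; _,_)
open import Data.Sum using (inj₁; inj₂)
open import Data.Empty using (⊥; ⊥-elim)
open import Relation.Binary.PropositionalEquality using (_≡_; refl; sym; trans; cong; subst)

private
  variable
    n : ℕ


mutual
  -- the filter local to `freeVertices`, named by unification
  keepFree : Labeling n → List (Fin n) → List (Fin n)
  keepFree = _

  freeVertices≡keepFree : (l : Labeling n) → freeVertices l ≡ keepFree l (allFin n)
  freeVertices≡keepFree {n} l with allFin n
  ... | _ = refl

keepFree⁺ : (l : Labeling n) {v : Fin n} (vs : List (Fin n)) →
            v ∈ vs → lookup l v ≡ nothing → v ∈ keepFree l vs
keepFree⁺ l (u ∷ vs) (here refl) free rewrite free = here refl
keepFree⁺ l (u ∷ vs) (there v∈vs) free with lookup l u
... | nothing = there (keepFree⁺ l vs v∈vs free)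
... | just _  = keepFree⁺ l vs v∈vs free

keepFree⁻ : (l : Labeling n) {v : Fin n} (vs : List (Fin n)) →
            v ∈ keepFree l vs → lookup l v ≡ nothing
keepFree⁻ l (u ∷ vs) v∈ with lookup l u in eq
keepFree⁻ l (u ∷ vs) (here refl)  | nothing = eq
keepFree⁻ l (u ∷ vs) (there v∈)   | nothing = keepFree⁻ l vs v∈
keepFree⁻ l (u ∷ vs) v∈           | just _  = keepFree⁻ l vs v∈

∈-freeVertices⁺ : (l : Labeling n) {v : Fin n} → lookup l v ≡ nothing → v ∈ freeVertices l
∈-freeVertices⁺ {n} l {v} free =
  subst (v ∈_) (sym (freeVertices≡keepFree l)) (keepFree⁺ l (allFin n) (∈-allFin v) free)

∈-freeVertices⁻ : (l : Labeling n) {v : Fin n} → v ∈ freeVertices l → lookup l v ≡ nothing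
∈-freeVertices⁻ {n} l v∈ = keepFree⁻ l (allFin n) (subst (_ ∈_) (freeVertices≡keepFree l) v∈)

freeCount : Labeling n → ℕ
freeCount []            = 0
freeCount (nothing ∷ l) = suc (freeCount l)
freeCount (just _ ∷ l)  = freeCount l

freeCount-replicate : ∀ n → freeCount (replicate n nothing) ≡ n
freeCount-replicate zero    = refl
freeCount-replicate (suc n) = cong suc (freeCount-replicate n)

freeCount-fill : (l : Labeling n) {v : Fin n} (b : Bool) → lookup l v ≡ nothing →
                 freeCount l ≡ suc (freeCount (l [ v ]≔ just b))
freeCount-fill (nothing ∷ l) {zero}  b free = refl
freeCount-fill (nothing ∷ l) {suc v} b free = cong suc (freeCount-fill l b free)
freeCount-fill (just _ ∷ l)  {suc v} b free = freeCount-fill l b free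

freeCount-fill-suc : (l : Labeling n) {v : Fin n} {k : ℕ} (b : Bool) →
                     freeCount l ≡ suc k → lookup l v ≡ nothing → freeCount (l [ v ]≔ just b) ≡ k
freeCount-fill-suc l b count free = ℕ.suc-injective (trans (sym (freeCount-fill l b free)) count)

freeCount-zero : (l : Labeling n) {v : Fin n} → freeCount l ≡ 0 → lookup l v ≡ nothing → ⊥
freeCount-zero l full free = ℕ.0≢1+n (trans (sym full) (freeCount-fill l true free))

free-vertex : (l : Labeling n) {k : ℕ} → freeCount l ≡ suc k → ∃ λ v → lookup l v ≡ nothing
free-vertex (nothing ∷ l) count = zero , refl
free-vertex (just _ ∷ l)  count with free-vertex l count
... | v , free = suc v , free


best∈ : ∀ p (x : ℤ) xs → best p x xs ∈ x ∷ xs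
best∈ Admirable x []       = here refl
best∈ Admirable x (y ∷ xs) with ⊓-sel x (best Admirable y xs)
... | inj₁ eq rewrite eq = here refl
... | inj₂ eq rewrite eq = there (best∈ Admirable y xs)
best∈ Impish    x []       = here refl
best∈ Impish    x (y ∷ xs) with ⊔-sel x (best Impish y xs)
... | inj₁ eq rewrite eq = here refl
... | inj₂ eq rewrite eq = there (best∈ Impish y xs)

best-Admirable≤ : ∀ {x y : ℤ} {xs} → y ∈ x ∷ xs → best Admirable x xs ≤ y
best-Admirable≤ {xs = []}     (here refl) = ≤-refl
best-Admirable≤ {xs = _ ∷ _}  (here refl) = i⊓j≤i _ _
best-Admirable≤ {xs = _ ∷ _}  (there y∈)  = ≤-trans (i⊓j≤j _ _) (best-Admirable≤ y∈)

≤best-Impish : ∀ {x y : ℤ} {xs} → y ∈ x ∷ xs → y ≤ best Impish x xs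
≤best-Impish {xs = []}    (here refl) = ≤-refl
≤best-Impish {xs = _ ∷ _} (here refl) = i≤i⊔j _ _
≤best-Impish {xs = _ ∷ _} (there y∈)  = ≤-trans (≤best-Impish y∈) (i≤j⊔i _ _)

optimum : Player → ℤ → List ℤ → ℤ
optimum p d []       = d
optimum p d (y ∷ ys) = best p y ys

optimum∈ : ∀ {p d y ys} → y ∈ ys → optimum p d ys ∈ ys
optimum∈ {p} {ys = y ∷ ys} _ = best∈ p y ys

optimum-Admirable≤ : ∀ {d y ys} → y ∈ ys → optimum Admirable d ys ≤ y
optimum-Admirable≤ {ys = _ ∷ _} y∈ = best-Admirable≤ y∈

≤optimum-Impish : ∀ {d y ys} → y ∈ ys → y ≤ optimum Impish d ys
≤optimum-Impish {ys = _ ∷ _} y∈ = ≤best-Impish y∈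

optimum≤ : ∀ {p d B ys} → d ≤ B → (∀ {y} → y ∈ ys → y ≤ B) → optimum p d ys ≤ B
optimum≤ {ys = []}    d≤B ys≤B = d≤B
optimum≤ {p} {d} {ys = _ ∷ _} d≤B ys≤B = ys≤B (optimum∈ {p} {d} (here refl))


moveValues : Graph n → ℕ → Player → Labeling n → List ℤ
moveValues G k p l = map (λ v → value G k (other p) (l [ v ]≔ just (label p))) (freeVertices l)

value-suc : (G : Graph n) (k : ℕ) (p : Player) (l : Labeling n) →
            value G (suc k) p l ≡ optimum p (discrepancy G l) (moveValues G k p l)
value-suc G k p l with map (λ v → value G k (other p) (l [ v ]≔ just (label p))) (freeVertices l)
... | []    = refl
... | _ ∷ _ = refl

∈-moveValues : (G : Graph n) (k : ℕ) (p : Player) (l : Labeling n) {v : Fin n} →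
               lookup l v ≡ nothing →
               value G k (other p) (l [ v ]≔ just (label p)) ∈ moveValues G k p l
∈-moveValues G k p l free = ∈-map⁺ _ (∈-freeVertices⁺ l free)

value-attained : (G : Graph n) (k : ℕ) (p : Player) (l : Labeling n) {v : Fin n} →
                 lookup l v ≡ nothing →
                 ∃ λ u → lookup l u ≡ nothing ×
                         value G (suc k) p l ≡ value G k (other p) (l [ u ]≔ just (label p))
value-attained G k p l {v} free with ∈-map⁻ _ (optimum∈ (∈-moveValues G k p l {v} free))
... | u , u∈ , eq = u , ∈-freeVertices⁻ l u∈ , trans (value-suc G k p l) eq

value-Admirable≤ : (G : Graph n) (k : ℕ) (l : Labeling n) {v : Fin n} → lookup l v ≡ nothing →
                   value G (suc k) Admirable l ≤ value G k Impish (l [ v ]≔ just false)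
value-Admirable≤ G k l {v} free rewrite value-suc G k Admirable l =
  optimum-Admirable≤ (∈-moveValues G k Admirable l {v} free)

value-Impish≥ : (G : Graph n) (k : ℕ) (l : Labeling n) {v : Fin n} → lookup l v ≡ nothing →
                value G k Admirable (l [ v ]≔ just true) ≤ value G (suc k) Impish l
value-Impish≥ G k l {v} free rewrite value-suc G k Impish l =
  ≤optimum-Impish (∈-moveValues G k Impish l {v} free)

value≤-moves : (G : Graph n) (k : ℕ) (p : Player) (l : Labeling n) {B : ℤ} →
               discrepancy G l ≤ B →
               (∀ u → lookup l u ≡ nothing → value G k (other p) (l [ u ]≔ just (label p)) ≤ B) →
               value G (suc k) p l ≤ B
value≤-moves G k p l {B} d≤B moves≤B rewrite value-suc G k p l = optimum≤ d≤B bound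
  where
  bound : ∀ {y} → y ∈ moveValues G k p l → y ≤ B
  bound y∈ with ∈-map⁻ _ y∈
  ... | u , u∈ , refl = moves≤B u (∈-freeVertices⁻ l u∈)

outcome : Graph n → Player → Labeling n → ℤ
outcome G p l = value G (freeCount l) p l

gameValue≡outcome : (G : Graph n) (p : Player) → gameValue G p ≡ outcome G p (replicate n nothing)
gameValue≡outcome {n} G p = cong (λ k → value G k p (replicate n nothing)) (sym (freeCount-replicate n))

outcome-full : (G : Graph n) (p : Player) {l : Labeling n} →
               freeCount l ≡ 0 → outcome G p l ≡ discrepancy G l
outcome-full G p {l} full = cong (λ k → value G k p l) full

outcome-Admirable≤ : (G : Graph n) (l : Labeling n) {v : Fin n} → lookup l v ≡ nothing →
                     outcome G Admirable l ≤ outcome G Impish (l [ v ]≔ just false)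
outcome-Admirable≤ G l {v} free =
  subst (λ k → value G k Admirable l ≤ outcome G Impish (l [ v ]≔ just false))
        (sym (freeCount-fill l false free))
        (value-Admirable≤ G (freeCount (l [ v ]≔ just false)) l {v} free)

outcome-Impish≥ : (G : Graph n) (l : Labeling n) {v : Fin n} → lookup l v ≡ nothing →
                  outcome G Admirable (l [ v ]≔ just true) ≤ outcome G Impish l
outcome-Impish≥ G l {v} free =
  subst (λ k → outcome G Admirable (l [ v ]≔ just true) ≤ value G k Impish l)
        (sym (freeCount-fill l true free))
        (value-Impish≥ G (freeCount (l [ v ]≔ just true)) l {v} free)

outcome-attained : (G : Graph n) (p : Player) (l : Labeling n) {v : Fin n} → lookup l v ≡ nothing →
                   ∃ λ u → lookup l u ≡ nothing ×
                           outcome G p l ≡ outcome G (other p) (l [ u ]≔ just (label p))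
outcome-attained G p l {v} free
  with value-attained G (freeCount (l [ v ]≔ just (label p))) p l {v} free
... | u , u-free , eq = u , u-free , trans (cong (λ k → value G k p l) count) (trans eq count-after)
  where
  count = freeCount-fill l (label p) free
  count-after : value G (freeCount (l [ v ]≔ just (label p))) (other p) (l [ u ]≔ just (label p))
              ≡ outcome G (other p) (l [ u ]≔ just (label p))
  count-after = cong (λ k → value G k (other p) _) (sym (freeCount-fill-suc l (label p) count u-free))

MovesBounded : Graph n → Player → Labeling n → ℤ → Set
MovesBounded G p l B = ∀ u → lookup l u ≡ nothing → outcome G (other p) (l [ u ]≔ just (label p)) ≤ B

outcome≤-moves : (G : Graph n) (p : Player) (l : Labeling n) {v : Fin n} {B : ℤ} →
                 lookup l v ≡ nothing → MovesBounded G p l B → outcome G p l ≤ B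
outcome≤-moves G p l {v} {B} free moves≤B with outcome-attained G p l {v} free
... | u , u-free , eq = subst (_≤ B) (sym eq) (moves≤B u u-free)

-- agrees definitionally with the relabelling used in `pathEdges`
shift : Fin n × Fin n → Fin (suc n) × Fin (suc n)
shift (i , j) = suc i , suc j

discrepancy-shift : (E : Graph n) (x : Maybe Bool) (l : Labeling n) →
                    discrepancy (map shift E) (x ∷ l) ≡ discrepancy E l
discrepancy-shift []             x l = refl
discrepancy-shift ((i , j) ∷ E) x l =
  cong (_+_ (edgeVal (lookup l i) (lookup l j))) (discrepancy-shift E x l)

edgeVal≤1 : ∀ x y → edgeVal x y ≤ + 1
edgeVal≤1 nothing      y            = +≤+ z≤n
edgeVal≤1 (just _)     nothing      = +≤+ z≤n
edgeVal≤1 (just false) (just false) = -≤+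
edgeVal≤1 (just false) (just true)  = ≤-refl
edgeVal≤1 (just true)  (just false) = ≤-refl
edgeVal≤1 (just true)  (just true)  = -≤+

-- The index counts the unlabelled vertices of the pair; it makes the recursion in
-- `pairing-bound` structural.
data Paired : ℕ → Maybe Bool → Maybe Bool → Set where
  unplayed : Paired 2 nothing nothing
  played   : ∀ x → Paired 0 (just x) (just (not x))

edgeVal-Paired : ∀ {i a c} → Paired i a c → ∀ b → edgeVal a b + edgeVal b c ≡ + 0
edgeVal-Paired unplayed       nothing      = refl
edgeVal-Paired unplayed       (just _)     = refl
edgeVal-Paired (played _)     nothing      = refl
edgeVal-Paired (played false) (just false) = refl
edgeVal-Paired (played false) (just true)  = refl
edgeVal-Paired (played true)  (just false) = refl
edgeVal-Paired (played true)  (just true)  = refl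

module Extension (m : ℕ) where

  Pₙ : Graph (suc m)
  Pₙ = P (suc m)

  Pₙ₊₄ : Graph (4 Data.Nat.+ suc m)
  Pₙ₊₄ = P (4 Data.Nat.+ suc m)

  discrepancy-bound : ∀ {i a c} → Paired i a c → ∀ b d (l : Labeling (suc m)) →
                      discrepancy Pₙ₊₄ (a ∷ b ∷ c ∷ d ∷ l) ≤ discrepancy Pₙ l + + 2
  discrepancy-bound {a = a} {c} ac b d l = begin
    discrepancy Pₙ₊₄ (a ∷ b ∷ c ∷ d ∷ l)
      ≡⟨ cong (λ t → edgeVal a b + (edgeVal b c + (edgeVal c d + (e₃₄ + t)))) shifted ⟩
    edgeVal a b + (edgeVal b c + (edgeVal c d + (e₃₄ + D)))
      ≡⟨ sym (+-assoc (edgeVal a b) (edgeVal b c) _) ⟩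
    (edgeVal a b + edgeVal b c) + (edgeVal c d + (e₃₄ + D))
      ≡⟨ cong (_+ (edgeVal c d + (e₃₄ + D))) (edgeVal-Paired ac b) ⟩
    + 0 + (edgeVal c d + (e₃₄ + D))
      ≡⟨ +-identityˡ _ ⟩
    edgeVal c d + (e₃₄ + D)
      ≤⟨ +-mono-≤ (edgeVal≤1 c d) (+-monoˡ-≤ D (edgeVal≤1 d _)) ⟩
    + 1 + (+ 1 + D)
      ≡⟨ sym (+-assoc (+ 1) (+ 1) D) ⟩
    + 2 + D
      ≡⟨ +-comm (+ 2) D ⟩
    D + + 2 ∎
    where
    open ≤-Reasoning
    D = discrepancy Pₙ l
    e₃₄ = edgeVal d (lookup l zero)
    shifted : discrepancy (map shift (map shift (map shift (map shift Pₙ)))) (a ∷ b ∷ c ∷ d ∷ l) ≡ D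
    shifted = trans (discrepancy-shift (map shift (map shift (map shift Pₙ))) a _)
             (trans (discrepancy-shift (map shift (map shift Pₙ)) b _)
             (trans (discrepancy-shift (map shift Pₙ) c _)
                    (discrepancy-shift Pₙ d l)))

  opposite-pair-bound : (l : Labeling (suc m)) → freeCount l ≡ 0 → ∀ p x b d →
                        outcome Pₙ₊₄ p (just x ∷ b ∷ just (not x) ∷ d ∷ l) ≤ discrepancy Pₙ l + + 2
  opposite-pair-bound l full p x b d = bound (freeCount (just x ∷ b ∷ just (not x) ∷ d ∷ l)) p b d
    where
    bound : ∀ k p b d → value Pₙ₊₄ k p (just x ∷ b ∷ just (not x) ∷ d ∷ l) ≤ discrepancy Pₙ l + + 2
    bound zero    p b d = discrepancy-bound (played x) b d l
    bound (suc k) p b d = value≤-moves Pₙ₊₄ k p _ (discrepancy-bound (played x) b d l) move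
      where
      move : ∀ u → lookup (just x ∷ b ∷ just (not x) ∷ d ∷ l) u ≡ nothing →
             value Pₙ₊₄ k (other p) ((just x ∷ b ∷ just (not x) ∷ d ∷ l) [ u ]≔ just (label p))
               ≤ discrepancy Pₙ l + + 2
      move (suc zero)                _    = bound k (other p) _ d
      move (suc (suc (suc zero)))    _    = bound k (other p) b _
      move (suc (suc (suc (suc v)))) free = ⊥-elim (freeCount-zero l {v} full free)
      move zero                      ()
      move (suc (suc zero))          ()

  endgame-bound : ∀ {i j a b c d} (l : Labeling (suc m)) → freeCount l ≡ 0 →
                  Paired i a c → Paired j b d →
                  outcome Pₙ₊₄ Admirable (a ∷ b ∷ c ∷ d ∷ l) ≤ discrepancy Pₙ l + + 2
  endgame-bound {b = b} {d = d} l full (played x) _ = opposite-pair-bound l full Admirable x b d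
  endgame-bound l full unplayed (played y) =
    ≤-trans (outcome-Admirable≤ Pₙ₊₄ (nothing ∷ just y ∷ nothing ∷ just (not y) ∷ l) {zero} refl)
            (outcome≤-moves Pₙ₊₄ Impish (just false ∷ just y ∷ nothing ∷ just (not y) ∷ l)
                            {suc (suc zero)} refl answer)
    where
    answer : MovesBounded Pₙ₊₄ Impish (just false ∷ just y ∷ nothing ∷ just (not y) ∷ l)
                          (discrepancy Pₙ l + + 2)
    answer (suc (suc zero))          _    = opposite-pair-bound l full Admirable false (just y) (just (not y))
    answer (suc (suc (suc (suc v)))) free = ⊥-elim (freeCount-zero l {v} full free)
    answer zero                      ()
    answer (suc zero)                ()
    answer (suc (suc (suc zero)))    ()
  endgame-bound l full unplayed unplayed =
    ≤-trans (outcome-Admirable≤ Pₙ₊₄ (nothing ∷ nothing ∷ nothing ∷ nothing ∷ l) {suc zero} refl)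
            (outcome≤-moves Pₙ₊₄ Impish (nothing ∷ just false ∷ nothing ∷ nothing ∷ l) {zero} refl answer)
    where
    answer : MovesBounded Pₙ₊₄ Impish (nothing ∷ just false ∷ nothing ∷ nothing ∷ l)
                          (discrepancy Pₙ l + + 2)
    answer zero                      _    =
      ≤-trans (outcome-Admirable≤ Pₙ₊₄ (just true ∷ just false ∷ nothing ∷ nothing ∷ l)
                                  {suc (suc zero)} refl)
              (opposite-pair-bound l full Impish true (just false) nothing)
    answer (suc (suc zero))          _    =
      ≤-trans (outcome-Admirable≤ Pₙ₊₄ (nothing ∷ just false ∷ just true ∷ nothing ∷ l) {zero} refl)
              (opposite-pair-bound l full Impish false (just false) nothing)
    answer (suc (suc (suc zero)))    _    = endgame-bound l full unplayed (played false)
    answer (suc (suc (suc (suc v)))) free = ⊥-elim (freeCount-zero l {v} full free)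
    answer (suc zero)                ()

  mutual
    pairing-bound : ∀ p k {i j a b c d} (l : Labeling (suc m)) → freeCount l ≡ k →
                    Paired i a c → Paired j b d →
                    outcome Pₙ₊₄ p (a ∷ b ∷ c ∷ d ∷ l) ≤ outcome Pₙ p l + + 2
    pairing-bound Admirable zero {a = a} {b} {c} {d} l full ac bd =
      subst (λ t → outcome Pₙ₊₄ Admirable (a ∷ b ∷ c ∷ d ∷ l) ≤ t + + 2)
            (sym (outcome-full Pₙ Admirable {l} full)) (endgame-bound l full ac bd)
    pairing-bound Admirable (suc k) {a = a} {b} {c} {d} l count ac bd =
      let v , v-free = free-vertex l count
          u , u-free , optimal = outcome-attained Pₙ Admirable l {v} v-free
      in begin
      outcome Pₙ₊₄ Admirable (a ∷ b ∷ c ∷ d ∷ l)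
        ≤⟨ outcome-Admirable≤ Pₙ₊₄ (a ∷ b ∷ c ∷ d ∷ l) {suc (suc (suc (suc u)))} u-free ⟩
      outcome Pₙ₊₄ Impish (a ∷ b ∷ c ∷ d ∷ l [ u ]≔ just false)
        ≤⟨ pairing-bound Impish k _ (freeCount-fill-suc l false count u-free) ac bd ⟩
      outcome Pₙ Impish (l [ u ]≔ just false) + + 2
        ≡⟨ cong (_+ + 2) (sym optimal) ⟩
      outcome Pₙ Admirable l + + 2 ∎
      where open ≤-Reasoning
    pairing-bound Impish zero l full (played x) (played y) = begin
      outcome Pₙ₊₄ Impish L     ≡⟨ outcome-full Pₙ₊₄ Impish {L} full ⟩
      discrepancy Pₙ₊₄ L        ≤⟨ discrepancy-bound (played x) (just y) (just (not y)) l ⟩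
      discrepancy Pₙ l + + 2    ≡⟨ cong (_+ + 2) (sym (outcome-full Pₙ Impish {l} full)) ⟩
      outcome Pₙ Impish l + + 2 ∎
      where
      open ≤-Reasoning
      L = just x ∷ just y ∷ just (not x) ∷ just (not y) ∷ l
    pairing-bound Impish (suc k) l count (played x) (played y) =
      let v , v-free = free-vertex l count
      in outcome≤-moves Pₙ₊₄ Impish (just x ∷ just y ∷ just (not x) ∷ just (not y) ∷ l)
                        {suc (suc (suc (suc v)))} v-free
                        (pairing-reply (suc k) l count (played x) (played y))
    pairing-bound Impish k {b = b} {d = d} l count unplayed bd =
      outcome≤-moves Pₙ₊₄ Impish (nothing ∷ b ∷ nothing ∷ d ∷ l) {zero} refl
                     (pairing-reply k l count unplayed bd)
    pairing-bound Impish k l count (played x) unplayed =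
      outcome≤-moves Pₙ₊₄ Impish (just x ∷ nothing ∷ just (not x) ∷ nothing ∷ l) {suc zero} refl
                     (pairing-reply k l count (played x) unplayed)

    pairing-reply : ∀ k {i j a b c d} (l : Labeling (suc m)) → freeCount l ≡ k →
                    Paired i a c → Paired j b d →
                    MovesBounded Pₙ₊₄ Impish (a ∷ b ∷ c ∷ d ∷ l) (outcome Pₙ Impish l + + 2)
    pairing-reply k {b = b} {d = d} l count unplayed bd zero _ =
      ≤-trans (outcome-Admirable≤ Pₙ₊₄ (just true ∷ b ∷ nothing ∷ d ∷ l) {suc (suc zero)} refl)
              (pairing-bound Impish k l count (played true) bd)
    pairing-reply k {b = b} {d = d} l count unplayed bd (suc (suc zero)) _ =
      ≤-trans (outcome-Admirable≤ Pₙ₊₄ (nothing ∷ b ∷ just true ∷ d ∷ l) {zero} refl)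
              (pairing-bound Impish k l count (played false) bd)
    pairing-reply k {a = a} {c = c} l count ac unplayed (suc zero) _ =
      ≤-trans (outcome-Admirable≤ Pₙ₊₄ (a ∷ just true ∷ c ∷ nothing ∷ l) {suc (suc (suc zero))} refl)
              (pairing-bound Impish k l count ac (played true))
    pairing-reply k {a = a} {c = c} l count ac unplayed (suc (suc (suc zero))) _ =
      ≤-trans (outcome-Admirable≤ Pₙ₊₄ (a ∷ nothing ∷ c ∷ just true ∷ l) {suc zero} refl)
              (pairing-bound Impish k l count ac (played false))
    pairing-reply zero l full ac bd (suc (suc (suc (suc v)))) free =
      ⊥-elim (freeCount-zero l {v} full free)
    pairing-reply (suc k) l count ac bd (suc (suc (suc (suc v)))) free =
      ≤-trans (pairing-bound Admirable k _ (freeCount-fill-suc l true count free) ac bd)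
              (+-monoˡ-≤ (+ 2) (outcome-Impish≥ Pₙ l {v} free))
    pairing-reply k l count (played x) bd zero                   ()
    pairing-reply k l count (played x) bd (suc (suc zero))       ()
    pairing-reply k l count ac (played y) (suc zero)             ()
    pairing-reply k l count ac (played y) (suc (suc (suc zero))) ()

  extension-bound : ∀ p → gameValue Pₙ₊₄ p ≤ gameValue Pₙ p + + 2
  extension-bound p = begin
    gameValue Pₙ₊₄ p                                  ≡⟨ gameValue≡outcome Pₙ₊₄ p ⟩
    outcome Pₙ₊₄ p (replicate (4 Data.Nat.+ suc m) nothing)
      ≤⟨ pairing-bound p (suc m) (replicate (suc m) nothing) (freeCount-replicate (suc m))
                       unplayed unplayed ⟩
    outcome Pₙ p (replicate (suc m) nothing) + + 2    ≡⟨ cong (_+ + 2) (sym (gameValue≡outcome Pₙ p)) ⟩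
    gameValue Pₙ p + + 2 ∎
    where open ≤-Reasoning

open Extension using (extension-bound)

lemma4p2 : (n : ℕ) → n ≥ 1 →
    (bA (P (n Data.Nat.+ 4)) ≤ bA (P n) + + 2) × (bI (P (n Data.Nat.+ 4)) ≤ bI (P n) + + 2)
lemma4p2 zero    ()
lemma4p2 (suc m) _  =
  subst (λ N → (bA (P N) ≤ bA (P (suc m)) + + 2) × (bI (P N) ≤ bI (P (suc m)) + + 2))
        (ℕ.+-comm 4 (suc m))
        (extension-bound m Admirable , extension-bound m Impish)
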